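{- Over intuitionistic logic (arithmetic), the principles DNS$^{\mathrm{V}}$ and MP together imply EnDec. Here DNS$^{\mathrm{V}}$ is the schema $\neg\neg\forall n\,(A(n)\vee\neg A(n))$ for every formula $A(n)$; MP is the schema $\neg\neg S\to S$ for every $\Sigma$-formula $S$; and EnDec is the statement: for every enumerable set $B\subseteq\mathbb{N}$, if for every decidable $C\subseteq B$ we have that $\exists m\,(m\notin C)$ implies $\exists m\,(m\notin C\wedge m\in B)$, then $\mathbb{N}\subseteq B$.
   Context: A $\Sigma$-formula is one built only from existential quantifiers over $\mathbb{N}$, disjunction, conjunction and equality of natural numbers. A set $B\subseteq\mathbb{N}$ is enumerable if membership $n\in B$ is given by a $\Sigma$-formula; a set $C\subseteq\mathbb{N}$ is decidable if $\forall n(n\in C\vee n\notin C)$. $n\notin C$ abbreviates $\neg(n\in C)$. -}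

module Defs where

open import Data.Nat using (ℕ; zero; suc; _+_; _*_)
open import Data.Fin using (Fin)
open import Data.Vec using (Vec; []; _∷_; lookup)
open import Data.Product using (Σ; ∃; _×_; _,_)
open import Data.Sum using (_⊎_)
open import Relation.Nullary using (¬_)
open import Relation.Binary.PropositionalEquality using (_≡_)

data Term (k : ℕ) : Set where
  var  : Fin k → Term k
  zer  : Term k
  suc' : Term k → Term k
  _⊕_  : Term k → Term k → Term k
  _⊗_  : Term k → Term k → Term k

⟦_⟧t : ∀ {k} → Term k → Vec ℕ k → ℕ
⟦ var i ⟧t ρ = lookup ρ i
⟦ zer ⟧t ρ = zero
⟦ suc' t ⟧t ρ = suc (⟦ t ⟧t ρ)
⟦ t ⊕ s ⟧t ρ = ⟦ t ⟧t ρ + ⟦ s ⟧t ρ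
⟦ t ⊗ s ⟧t ρ = ⟦ t ⟧t ρ * ⟦ s ⟧t ρ

data SigmaFm (k : ℕ) : Set where
  _≐_   : Term k → Term k → SigmaFm k
  _∧'_  : SigmaFm k → SigmaFm k → SigmaFm k
  _∨'_  : SigmaFm k → SigmaFm k → SigmaFm k
  ex    : SigmaFm (suc k) → SigmaFm k

⟦_⟧ : ∀ {k} → SigmaFm k → Vec ℕ k → Set
⟦ t ≐ s ⟧ ρ = ⟦ t ⟧t ρ ≡ ⟦ s ⟧t ρ
⟦ φ ∧' ψ ⟧ ρ = ⟦ φ ⟧ ρ × ⟦ ψ ⟧ ρ
⟦ φ ∨' ψ ⟧ ρ = ⟦ φ ⟧ ρ ⊎ ⟦ ψ ⟧ ρ
⟦ ex φ ⟧ ρ = Σ ℕ λ x → ⟦ φ ⟧ (x ∷ ρ)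

Subset : Set₁
Subset = ℕ → Set

Enumerable : Subset → Set
Enumerable B = Σ (SigmaFm 1) λ φ → ∀ n → (B n → ⟦ φ ⟧ (n ∷ [])) × (⟦ φ ⟧ (n ∷ []) → B n)

DecidableSet : Subset → Set
DecidableSet C = ∀ n → C n ⊎ ¬ C n

_⊆_ : Subset → Subset → Set
C ⊆ B = ∀ n → C n → B n

DNS-V : Set₁
DNS-V = (A : ℕ → Set) → ¬ ¬ (∀ n → A n ⊎ ¬ A n)

MP : Set
MP = ∀ {k} (S : SigmaFm k) (ρ : Vec ℕ k) → ¬ ¬ ⟦ S ⟧ ρ → ⟦ S ⟧ ρ

EnDec : Set₁
EnDec = (B : Subset) → Enumerable B →
        ((C : Subset) → DecidableSet C → C ⊆ B →
           (∃ λ m → ¬ C m) → ∃ λ m → ¬ C m × B m) →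
        ∀ n → B n

module Submission where

-- Let B be enumerable and satisfy the hypothesis of EnDec, and fix n.
--   * If B happens to be decidable, then B itself is an admissible C ⊆ B;
--     should n ∉ B, the hypothesis would yield some m with m ∉ B and m ∈ B,
--     which is absurd.  Hence a decidable B satisfying the hypothesis is
--     all of ℕ (lemma `decidable-with-witnesses-is-total`).
--   * DNS^V, instantiated at the formula A := B, says that B is decidable
--     "up to double negation"; mapping the first half under ¬¬ therefore
--     gives ¬¬ (n ∈ B).
--   * Membership in an enumerable set is a Σ-formula, so MP removes the
--     double negation (lemma `enumerable-stable`).

open import Defs
open import Data.Vec using ([]; _∷_)
open import Data.Product using (∃; _×_; _,_; proj₁; proj₂)
open import Data.Sum using (inj₁; inj₂)
open import Relation.Nullary using (¬_)
open import Relation.Nullary.Negation using (¬¬-map; contradiction)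

HasOutsideWitnesses : Subset → Set₁
HasOutsideWitnesses B =
  (C : Subset) → DecidableSet C → C ⊆ B →
  (∃ λ m → ¬ C m) → ∃ λ m → ¬ C m × B m

enumerable-stable : MP → (B : Subset) → Enumerable B →
                    ∀ n → ¬ ¬ B n → B n
enumerable-stable mp B (φ , B⇔φ) n ¬¬Bn =
  proj₂ (B⇔φ n) (mp φ (n ∷ []) (¬¬-map (proj₁ (B⇔φ n)) ¬¬Bn))

decidable-with-witnesses-is-total : (B : Subset) → DecidableSet B →
                                    HasOutsideWitnesses B → ∀ n → B n
decidable-with-witnesses-is-total B B? witnesses n with B? n
... | inj₁ Bn  = Bn
... | inj₂ ¬Bn with witnesses B B? (λ _ Bm → Bm) (n , ¬Bn)
...   | m , ¬Bm , Bm = contradiction Bm ¬Bm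

theorem2 : DNS-V → MP → EnDec
theorem2 dns mp B B-enum witnesses n =
  enumerable-stable mp B B-enum n
    (¬¬-map (λ B? → decidable-with-witnesses-is-total B B? witnesses n)
            (dns B))
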